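{- Let $\mathcal{T}_S$ be a source theory, $\mathcal{T}_B$ a bridging theory and $\mathcal{V}_A$ an abstract vocabulary (propositional logic). If $\langle\mathcal{T}^l,\mathcal{T}^u\rangle$ is an exact $\alpha$-abstraction from $\mathcal{T}_S$ with respect to $\mathcal{T}_B$ over $\mathcal{V}_A$, then it is the tightest abstraction from $\mathcal{T}_S$ with respect to $\mathcal{T}_B$ over $\mathcal{V}_A$.
   Context: Classical propositional logic. A theory is a finite set of formulas identified with the conjunction of its members; "a formula over $\mathcal{V}$" means all its variables lie in $\mathcal{V}$. $\models$ is classical entailment. An $\alpha$-abstraction from $\mathcal{T}_S$ with respect to $\mathcal{T}_B$ over $\mathcal{V}_A$ is a pair $\langle\mathcal{T}^l,\mathcal{T}^u\rangle$ of theories over $\mathcal{V}_A$ such that for every formula $C$ over $\mathcal{V}_A$, $\mathcal{T}_B\models C\rightarrow\mathcal{T}^l$ implies $\mathcal{T}_B\models C\rightarrow\mathcal{T}_S$, and for every formula $D$ over $\mathcal{V}_A$, $\mathcal{T}_B\models\mathcal{T}^u\rightarrow D$ implies $\mathcal{T}_B\models\mathcal{T}_S\rightarrow D$. It is exact if $\mathcal{T}_B\models\mathcal{T}^l\leftrightarrow\mathcal{T}^u$. The tightest abstraction from $\mathcal{T}_S$ with respect to $\mathcal{T}_B$ over $\mathcal{V}_A$ is the pair $\langle\mathcal{T}^l,\mathcal{T}^u\rangle$ of theories over $\mathcal{V}_A$ where $\mathcal{T}^l$ is the weakest (w.r.t. implication) theory over $\mathcal{V}_A$ such that for every formula $C$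 over $\mathcal{V}_A$, $\mathcal{T}_B\models C\rightarrow\mathcal{T}_S$ iff $\mathcal{T}_B\models C\rightarrow\mathcal{T}^l$, and $\mathcal{T}^u$ is the strongest (w.r.t. implication) theory over $\mathcal{V}_A$ such that for every formula $D$ over $\mathcal{V}_A$, $\mathcal{T}_B\models\mathcal{T}_S\rightarrow D$ iff $\mathcal{T}_B\models\mathcal{T}^u\rightarrow D$. -}

module Defs where

open import Data.Bool using (Bool; true; false; not; _∧_; _∨_)
open import Data.List using (List; []; _∷_)
open import Data.List.Relation.Unary.All using (All)
open import Data.Product using (_×_)
open import Data.Unit using (⊤)
open import Relation.Binary.PropositionalEquality using (_≡_)

data Formula (Atom : Set) : Set where
  ⊤ᶠ ⊥ᶠ : Formula Atom
  var   : Atom → Formula Atom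
  ¬ᶠ_   : Formula Atom → Formula Atom
  _∧ᶠ_ _∨ᶠ_ _⇒ᶠ_ _⇔ᶠ_ : Formula Atom → Formula Atom → Formula Atom

infixr 4 _⇒ᶠ_ _⇔ᶠ_
infixr 5 _∨ᶠ_
infixr 6 _∧ᶠ_
infix 7 ¬ᶠ_

module _ {Atom : Set} where

  Valuation : Set
  Valuation = Atom → Bool

  ⟦_⟧ : Formula Atom → Valuation → Bool
  ⟦ ⊤ᶠ ⟧ v = true
  ⟦ ⊥ᶠ ⟧ v = false
  ⟦ var a ⟧ v = v a
  ⟦ ¬ᶠ φ ⟧ v = not (⟦ φ ⟧ v)
  ⟦ φ ∧ᶠ ψ ⟧ v = ⟦ φ ⟧ v ∧ ⟦ ψ ⟧ v
  ⟦ φ ∨ᶠ ψ ⟧ v = ⟦ φ ⟧ v ∨ ⟦ ψ ⟧ v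
  ⟦ φ ⇒ᶠ ψ ⟧ v = not (⟦ φ ⟧ v) ∨ ⟦ ψ ⟧ v
  ⟦ φ ⇔ᶠ ψ ⟧ v = (⟦ φ ⟧ v ∧ ⟦ ψ ⟧ v) ∨ (not (⟦ φ ⟧ v) ∧ not (⟦ ψ ⟧ v))

  Theory : Set
  Theory = List (Formula Atom)

  ⋀ : Theory → Formula Atom
  ⋀ [] = ⊤ᶠ
  ⋀ (φ ∷ T) = φ ∧ᶠ ⋀ T

  _⊨_ : Theory → Formula Atom → Set
  T ⊨ φ = (v : Valuation) → All (λ ψ → ⟦ ψ ⟧ v ≡ true) T → ⟦ φ ⟧ v ≡ true

  Vocabulary : Set₁
  Vocabulary = Atom → Set

  Over : Vocabulary → Formula Atom → Set
  Over V ⊤ᶠ = ⊤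
  Over V ⊥ᶠ = ⊤
  Over V (var a) = V a
  Over V (¬ᶠ φ) = Over V φ
  Over V (φ ∧ᶠ ψ) = Over V φ × Over V ψ
  Over V (φ ∨ᶠ ψ) = Over V φ × Over V ψ
  Over V (φ ⇒ᶠ ψ) = Over V φ × Over V ψ
  Over V (φ ⇔ᶠ ψ) = Over V φ × Over V ψ

  TheoryOver : Vocabulary → Theory → Set
  TheoryOver V T = All (Over V) T

  IsAlphaAbstraction : (TS TB : Theory) (VA : Vocabulary) (Tl Tu : Theory) → Set
  IsAlphaAbstraction TS TB VA Tl Tu =
    TheoryOver VA Tl × TheoryOver VA Tu
    × ((C : Formula Atom) → Over VA C → TB ⊨ (C ⇒ᶠ ⋀ Tl) → TB ⊨ (C ⇒ᶠ ⋀ TS))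
    × ((D : Formula Atom) → Over VA D → TB ⊨ (⋀ Tu ⇒ᶠ D) → TB ⊨ (⋀ TS ⇒ᶠ D))

  IsExactAlphaAbstraction : (TS TB : Theory) (VA : Vocabulary) (Tl Tu : Theory) → Set
  IsExactAlphaAbstraction TS TB VA Tl Tu =
    IsAlphaAbstraction TS TB VA Tl Tu × TB ⊨ (⋀ Tl ⇔ᶠ ⋀ Tu)

  LowerFaithful : (TS TB : Theory) (VA : Vocabulary) (T : Theory) → Set
  LowerFaithful TS TB VA T =
    (C : Formula Atom) → Over VA C →
      (TB ⊨ (C ⇒ᶠ ⋀ TS) → TB ⊨ (C ⇒ᶠ ⋀ T)) × (TB ⊨ (C ⇒ᶠ ⋀ T) → TB ⊨ (C ⇒ᶠ ⋀ TS))

  UpperFaithful : (TS TB : Theory) (VA : Vocabulary) (T : Theory) → Set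
  UpperFaithful TS TB VA T =
    (D : Formula Atom) → Over VA D →
      (TB ⊨ (⋀ TS ⇒ᶠ D) → TB ⊨ (⋀ T ⇒ᶠ D)) × (TB ⊨ (⋀ T ⇒ᶠ D) → TB ⊨ (⋀ TS ⇒ᶠ D))

  IsTightestAbstraction : (TS TB : Theory) (VA : Vocabulary) (Tl Tu : Theory) → Set
  IsTightestAbstraction TS TB VA Tl Tu =
    (TheoryOver VA Tl × LowerFaithful TS TB VA Tl
      × ((T : Theory) → TheoryOver VA T → LowerFaithful TS TB VA T → TB ⊨ (⋀ T ⇒ᶠ ⋀ Tl)))
    × (TheoryOver VA Tu × UpperFaithful TS TB VA Tu
      × ((T : Theory) → TheoryOver VA T → UpperFaithful TS TB VA T → TB ⊨ (⋀ Tu ⇒ᶠ ⋀ T)))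

{-# OPTIONS --safe #-}
module Submission where

open import Defs
open import Data.Bool using (true; false; not; _∧_; _∨_)
open import Data.List.Relation.Unary.All using ([]; _∷_)
open import Data.Product using (_,_; proj₂)
open import Data.Unit using (tt)
open import Relation.Binary.PropositionalEquality using (_≡_; refl; sym; subst)

-- Exactness gives Tᵘ ⇒ Tˡ modulo T_B, so the upper condition applied to
-- D = ⋀ Tˡ yields T_S ⇒ Tˡ, and the lower condition applied to C = ⋀ Tᵘ yields
-- Tᵘ ⇒ T_S. Hence Tˡ, T_S and Tᵘ are all equivalent modulo T_B. Any theory T
-- over V_A that is lower-faithful to T_S entails T_S (take C = ⋀ T), hence Tˡ;
-- dually, T_S, hence Tᵘ, entails any upper-faithful T.

⇒ᵇ-intro : ∀ a {b} → (a ≡ true → b ≡ true) → not a ∨ b ≡ true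
⇒ᵇ-intro false _ = refl
⇒ᵇ-intro true  f = f refl

⇒ᵇ-elim : ∀ {a b} → not a ∨ b ≡ true → a ≡ true → b ≡ true
⇒ᵇ-elim {true} b≡true refl = b≡true

⇔ᵇ-elim : ∀ {a b} → (a ∧ b) ∨ (not a ∧ not b) ≡ true → a ≡ b
⇔ᵇ-elim {true}  {true}  _ = refl
⇔ᵇ-elim {false} {false} _ = refl

Over-⋀ : ∀ {Atom} {V : Vocabulary {Atom}} {T : Theory} → TheoryOver V T → Over V (⋀ T)
Over-⋀ []       = tt
Over-⋀ (o ∷ os) = o , Over-⋀ os

module _ {Atom : Set} (TB : Theory {Atom}) where

  ⊨-⇒-refl : (φ : Formula Atom) → TB ⊨ (φ ⇒ᶠ φ)
  ⊨-⇒-refl φ v _ = ⇒ᵇ-intro (⟦ φ ⟧ v) (λ φ-holds → φ-holds)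

  ⊨-⇒-trans : (φ ψ χ : Formula Atom) → TB ⊨ (φ ⇒ᶠ ψ) → TB ⊨ (ψ ⇒ᶠ χ) → TB ⊨ (φ ⇒ᶠ χ)
  ⊨-⇒-trans φ ψ χ φ⇒ψ ψ⇒χ v v⊨TB =
    ⇒ᵇ-intro (⟦ φ ⟧ v) (λ φ-holds → ⇒ᵇ-elim (ψ⇒χ v v⊨TB) (⇒ᵇ-elim (φ⇒ψ v v⊨TB) φ-holds))

  ⊨-⇔⇒⇐ : (φ ψ : Formula Atom) → TB ⊨ (φ ⇔ᶠ ψ) → TB ⊨ (ψ ⇒ᶠ φ)
  ⊨-⇔⇒⇐ φ ψ φ⇔ψ v v⊨TB =
    ⇒ᵇ-intro (⟦ ψ ⟧ v) (subst (_≡ true) (sym (⇔ᵇ-elim (φ⇔ψ v v⊨TB))))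

module _ {Atom : Set} (TS TB : Theory {Atom}) (VA : Vocabulary {Atom}) where

  LowerFaithful⇒⊨ : (T : Theory) → TheoryOver VA T → LowerFaithful TS TB VA T
    → TB ⊨ (⋀ T ⇒ᶠ ⋀ TS)
  LowerFaithful⇒⊨ T T-over faithful =
    proj₂ (faithful (⋀ T) (Over-⋀ T-over)) (⊨-⇒-refl TB (⋀ T))

  UpperFaithful⇒⊨ : (T : Theory) → TheoryOver VA T → UpperFaithful TS TB VA T
    → TB ⊨ (⋀ TS ⇒ᶠ ⋀ T)
  UpperFaithful⇒⊨ T T-over faithful =
    proj₂ (faithful (⋀ T) (Over-⋀ T-over)) (⊨-⇒-refl TB (⋀ T))

  LowerFaithful-intro : (T : Theory) → TB ⊨ (⋀ TS ⇒ᶠ ⋀ T)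
    → ((C : Formula Atom) → Over VA C → TB ⊨ (C ⇒ᶠ ⋀ T) → TB ⊨ (C ⇒ᶠ ⋀ TS))
    → LowerFaithful TS TB VA T
  LowerFaithful-intro T TS⇒T sound C C-over =
    (λ C⇒TS → ⊨-⇒-trans TB C (⋀ TS) (⋀ T) C⇒TS TS⇒T) , sound C C-over

  UpperFaithful-intro : (T : Theory) → TB ⊨ (⋀ T ⇒ᶠ ⋀ TS)
    → ((D : Formula Atom) → Over VA D → TB ⊨ (⋀ T ⇒ᶠ D) → TB ⊨ (⋀ TS ⇒ᶠ D))
    → UpperFaithful TS TB VA T
  UpperFaithful-intro T T⇒TS sound D D-over =
    (λ TS⇒D → ⊨-⇒-trans TB (⋀ T) (⋀ TS) D T⇒TS TS⇒D) , sound D D-over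

proposition3 : {Atom : Set} (TS TB : Theory {Atom}) (VA : Vocabulary {Atom}) (Tl Tu : Theory {Atom})
    → IsExactAlphaAbstraction TS TB VA Tl Tu
    → IsTightestAbstraction TS TB VA Tl Tu
proposition3 TS TB VA Tl Tu ((Tl-over , Tu-over , lower , upper) , Tl⇔Tu) =
    (Tl-over , LowerFaithful-intro TS TB VA Tl TS⇒Tl lower , weakest)
  , (Tu-over , UpperFaithful-intro TS TB VA Tu Tu⇒TS upper , strongest)
  where
    Tu⇒Tl : TB ⊨ (⋀ Tu ⇒ᶠ ⋀ Tl)
    Tu⇒Tl = ⊨-⇔⇒⇐ TB (⋀ Tl) (⋀ Tu) Tl⇔Tu

    TS⇒Tl : TB ⊨ (⋀ TS ⇒ᶠ ⋀ Tl)
    TS⇒Tl = upper (⋀ Tl) (Over-⋀ Tl-over) Tu⇒Tl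

    Tu⇒TS : TB ⊨ (⋀ Tu ⇒ᶠ ⋀ TS)
    Tu⇒TS = lower (⋀ Tu) (Over-⋀ Tu-over) Tu⇒Tl

    weakest : (T : Theory) → TheoryOver VA T → LowerFaithful TS TB VA T → TB ⊨ (⋀ T ⇒ᶠ ⋀ Tl)
    weakest T T-over faithful =
      ⊨-⇒-trans TB (⋀ T) (⋀ TS) (⋀ Tl) (LowerFaithful⇒⊨ TS TB VA T T-over faithful) TS⇒Tl

    strongest : (T : Theory) → TheoryOver VA T → UpperFaithful TS TB VA T → TB ⊨ (⋀ Tu ⇒ᶠ ⋀ T)
    strongest T T-over faithful =
      ⊨-⇒-trans TB (⋀ Tu) (⋀ TS) (⋀ T) Tu⇒TS (UpperFaithful⇒⊨ TS TB VA T T-over faithful)
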